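{- Let $G$ be a finite simple triangle-free graph. If all maximal open packings of $G$ have the same cardinality, then no vertex of $G$ is adjacent to more than one support vertex.
   Context: A set $P$ of vertices is an open packing if no two distinct vertices of $P$ have a common neighbor; a maximal open packing is one maximal under inclusion. A support vertex is a vertex adjacent to at least one vertex of degree $1$. -}

module Defs where

open import Data.Nat using (ℕ)
open import Data.Fin using (Fin)
open import Data.Fin.Subset using (Subset; _∈_; _⊆_; ∣_∣)
open import Data.Product using (Σ; ∃; _×_)
open import Relation.Nullary using (¬_)
open import Relation.Binary.PropositionalEquality using (_≡_; _≢_)
open import Relation.Binary.Definitions using (Decidable)
open import Level using (0ℓ; suc)

record Graph (n : ℕ) : Set₁ where
  field
    Adj    : Fin n → Fin n → Set
    sym    : ∀ {u v} → Adj u v → Adj v u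
    irrefl : ∀ {v} → ¬ Adj v v
    dec    : Decidable Adj
open Graph public

TriangleFree : ∀ {n} → Graph n → Set
TriangleFree G = ∀ u v w → Adj G u v → Adj G v w → ¬ Adj G u w

DegreeOne : ∀ {n} → Graph n → Fin n → Set
DegreeOne G v = Σ _ λ u → Adj G v u × (∀ w → Adj G v w → w ≡ u)

Support : ∀ {n} → Graph n → Fin n → Set
Support G s = ∃ λ l → Adj G s l × DegreeOne G l

OpenPacking : ∀ {n} → Graph n → Subset n → Set
OpenPacking G P = ∀ u v → u ∈ P → v ∈ P → u ≢ v → ¬ (∃ λ w → Adj G u w × Adj G w v)

MaximalOpenPacking : ∀ {n} → Graph n → Subset n → Set
MaximalOpenPacking G P = OpenPacking G P × (∀ Q → P ⊆ Q → OpenPacking G Q → Q ⊆ P)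

module Submission where

-- Suppose v is adjacent to two distinct support vertices s and t,
-- with pendant vertices l (at s) and m (at t).  Extend {v} to a maximal
-- open packing Q.  Since N(l) = {s} ⊆ N(v) and N(m) = {t} ⊆ N(v), the set
-- (Q - v) ∪ {l} ∪ {m} is again an open packing: a conflict with l or m
-- would be a conflict with v, and l, m cannot conflict with each other as
-- s ≢ t.  It has one element more than Q, so extending it to a maximal
-- open packing gives one strictly larger than Q, contradicting the
-- hypothesis that all maximal open packings have equal size.

open import Defs
open import Data.Nat using (zero; suc; _∸_; _≤_; _<_; s≤s)
open import Data.Nat.Properties
  using (≤-pred; <-≤-trans; <⇒≢; ∸-monoʳ-<; m∸n≤m; n≮0; module ≤-Reasoning)
open import Data.Fin using (Fin; _≟_)
open import Data.Fin.Properties using (all?; any?)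
open import Data.Fin.Subset using (Subset; ∣_∣; _∈_; _∉_; _⊆_; _⊂_; ⁅_⁆; _∪_; _─_; _-_; inside; outside)
open import Data.Fin.Subset.Properties
  using (_∈?_; x∈⁅x⁆; x∈⁅y⁆⇒x≡y; x∉⁅y⁆⇒x≢y; x∈p∪q⁺; x∈p∪q⁻; p⊆p∪q; p─q⊆p;
         p─⊥≡p; p⊆q⇒∣p∣≤∣q∣; p⊂q⇒∣p∣<∣q∣; ∣p∣≤n)
open import Data.Vec using (_∷_; here; there)
open import Data.Product using (∃; _×_; _,_; proj₁)
open import Data.Sum using (_⊎_; inj₁; inj₂)
open import Data.Empty using (⊥-elim)
open import Relation.Nullary using (¬_; Dec; yes; no)
open import Relation.Nullary.Decidable using (¬?; _×-dec_; _→-dec_)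
open import Relation.Binary.PropositionalEquality
  using (_≡_; _≢_; refl; trans; cong; subst) renaming (sym to ≡-sym)

x∈p─q⇒x∉q : ∀ {n} {x : Fin n} (p q : Subset n) → x ∈ p ─ q → x ∉ q
x∈p─q⇒x∉q (_ ∷ p) (outside ∷ q) here        ()
x∈p─q⇒x∉q (_ ∷ p) (_ ∷ q)       (there x∈) (there x∈q) = x∈p─q⇒x∉q p q x∈ x∈q

∣p∣≡1+∣p-x∣ : ∀ {n} {x : Fin n} {p : Subset n} → x ∈ p → ∣ p ∣ ≡ suc ∣ p - x ∣
∣p∣≡1+∣p-x∣ {p = inside ∷ p}  here        = cong (λ q → suc ∣ q ∣) (≡-sym (p─⊥≡p p))
∣p∣≡1+∣p-x∣ {p = inside ∷ p}  (there x∈p) = cong suc (∣p∣≡1+∣p-x∣ x∈p)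
∣p∣≡1+∣p-x∣ {p = outside ∷ p} (there x∈p) = ∣p∣≡1+∣p-x∣ x∈p

p⊂p∪⁅x⁆ : ∀ {n} {x : Fin n} (p : Subset n) → x ∉ p → p ⊂ p ∪ ⁅ x ⁆
p⊂p∪⁅x⁆ {x = x} p x∉p = p⊆p∪q _ , x , x∈p∪q⁺ (inj₂ (x∈⁅x⁆ x)) , x∉p

∣p∣<∣p∪⁅x⁆∣ : ∀ {n} {x : Fin n} (p : Subset n) → x ∉ p → ∣ p ∣ < ∣ p ∪ ⁅ x ⁆ ∣
∣p∣<∣p∪⁅x⁆∣ p x∉p = p⊂q⇒∣p∣<∣q∣ (p⊂p∪⁅x⁆ p x∉p)

∣p∣<∣p-v∪x∪y∣ : ∀ {n} {v x y : Fin n} (p : Subset n)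
  → v ∈ p → x ∉ p → y ∉ p → x ≢ y → ∣ p ∣ < ∣ ((p - v) ∪ ⁅ x ⁆) ∪ ⁅ y ⁆ ∣
∣p∣<∣p-v∪x∪y∣ {v = v} {x} {y} p v∈p x∉p y∉p x≢y = begin-strict
  ∣ p ∣                           ≡⟨ ∣p∣≡1+∣p-x∣ v∈p ⟩
  suc ∣ p - v ∣                   <⟨ s≤s (∣p∣<∣p∪⁅x⁆∣ (p - v) x∉p-v) ⟩
  suc ∣ (p - v) ∪ ⁅ x ⁆ ∣         ≤⟨ ∣p∣<∣p∪⁅x⁆∣ ((p - v) ∪ ⁅ x ⁆) y∉p-v∪x ⟩
  ∣ ((p - v) ∪ ⁅ x ⁆) ∪ ⁅ y ⁆ ∣   ∎
  where
  open ≤-Reasoning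
  x∉p-v : x ∉ p - v
  x∉p-v x∈ = x∉p (p─q⊆p p ⁅ v ⁆ x∈)
  y∉p-v∪x : y ∉ (p - v) ∪ ⁅ x ⁆
  y∉p-v∪x y∈ with x∈p∪q⁻ (p - v) ⁅ x ⁆ y∈
  ... | inj₁ y∈p-v = y∉p (p─q⊆p p ⁅ v ⁆ y∈p-v)
  ... | inj₂ y∈x   = x≢y (≡-sym (x∈⁅y⁆⇒x≡y x y∈x))

module _ {n} (G : Graph n) where

  CommonNeighbour : Fin n → Fin n → Set
  CommonNeighbour u v = ∃ λ w → Adj G u w × Adj G w v

  common-sym : ∀ {u v} → CommonNeighbour u v → CommonNeighbour v u
  common-sym (w , uw , wv) = w , Graph.sym G wv , Graph.sym G uw

  NeighbourhoodWithin : Fin n → Fin n → Set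
  NeighbourhoodWithin x v = ∀ w → Adj G x w → Adj G v w

  packing-⊆ : ∀ {P Q} → P ⊆ Q → OpenPacking G Q → OpenPacking G P
  packing-⊆ P⊆Q opQ u v u∈P v∈P = opQ u v (P⊆Q u∈P) (P⊆Q v∈P)

  packing-⁅⁆ : ∀ x → OpenPacking G ⁅ x ⁆
  packing-⁅⁆ x u v u∈ v∈ u≢v _ =
    u≢v (trans (x∈⁅y⁆⇒x≡y x u∈) (≡-sym (x∈⁅y⁆⇒x≡y x v∈)))

  packing? : ∀ P → Dec (OpenPacking G P)
  packing? P = all? λ u → all? λ v →
    (u ∈? P) →-dec (v ∈? P) →-dec ¬? (u ≟ v) →-dec
    ¬? (any? λ w → dec G u w ×-dec dec G w v)

  packing-∪⁅⁆ : ∀ {P x} → OpenPacking G P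
              → (∀ u → u ∈ P → u ≢ x → ¬ CommonNeighbour u x)
              → OpenPacking G (P ∪ ⁅ x ⁆)
  packing-∪⁅⁆ {P} {x} opP free u v u∈ v∈ u≢v
    with x∈p∪q⁻ P ⁅ x ⁆ u∈ | x∈p∪q⁻ P ⁅ x ⁆ v∈
  ... | inj₁ u∈P | inj₁ v∈P = opP u v u∈P v∈P u≢v
  ... | inj₁ u∈P | inj₂ v∈x rewrite x∈⁅y⁆⇒x≡y x v∈x = free u u∈P u≢v
  ... | inj₂ u∈x | inj₁ v∈P rewrite x∈⁅y⁆⇒x≡y x u∈x =
    λ c → free v v∈P (λ v≡x → u≢v (≡-sym v≡x)) (common-sym c)
  ... | inj₂ u∈x | inj₂ v∈x =
    ⊥-elim (u≢v (trans (x∈⁅y⁆⇒x≡y x u∈x) (≡-sym (x∈⁅y⁆⇒x≡y x v∈x))))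

  maximal-or-extendable : ∀ P → OpenPacking G P
    → MaximalOpenPacking G P ⊎ (∃ λ x → x ∉ P × OpenPacking G (P ∪ ⁅ x ⁆))
  maximal-or-extendable P opP
    with any? (λ x → ¬? (x ∈? P) ×-dec packing? (P ∪ ⁅ x ⁆))
  ... | yes ext = inj₂ ext
  ... | no ¬ext = inj₁ (opP , maximal)
    where
    maximal : ∀ Q → P ⊆ Q → OpenPacking G Q → Q ⊆ P
    maximal Q P⊆Q opQ {x} x∈Q with x ∈? P
    ... | yes x∈P = x∈P
    ... | no x∉P = ⊥-elim (¬ext (x , x∉P , packing-⊆ P∪x⊆Q opQ))
      where
      P∪x⊆Q : P ∪ ⁅ x ⁆ ⊆ Q
      P∪x⊆Q y∈ with x∈p∪q⁻ P ⁅ x ⁆ y∈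
      ... | inj₁ y∈P = P⊆Q y∈P
      ... | inj₂ y∈x rewrite x∈⁅y⁆⇒x≡y x y∈x = x∈Q

  -- Every open packing extends to a maximal one.  The recursion is on a
  -- bound k for the number n ∸ ∣ P ∣ of vertices outside P.
  maximal-extension : ∀ P → OpenPacking G P
    → ∃ λ Q → P ⊆ Q × MaximalOpenPacking G Q
  maximal-extension P = extend n P (m∸n≤m n ∣ P ∣)
    where
    extend : ∀ k P → n ∸ ∣ P ∣ ≤ k → OpenPacking G P
           → ∃ λ Q → P ⊆ Q × MaximalOpenPacking G Q
    extend k P bound opP with maximal-or-extendable P opP
    ... | inj₁ maxP = P , (λ x∈P → x∈P) , maxP
    ... | inj₂ (x , x∉P , opP∪x) = continue k bound
      where
      fewer-outside : n ∸ ∣ P ∪ ⁅ x ⁆ ∣ < n ∸ ∣ P ∣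
      fewer-outside = ∸-monoʳ-< (∣p∣<∣p∪⁅x⁆∣ P x∉P) (∣p∣≤n (P ∪ ⁅ x ⁆))
      continue : ∀ k → n ∸ ∣ P ∣ ≤ k → ∃ λ Q → P ⊆ Q × MaximalOpenPacking G Q
      continue zero    b = ⊥-elim (n≮0 (<-≤-trans fewer-outside b))
      continue (suc k) b with extend k (P ∪ ⁅ x ⁆) (≤-pred (<-≤-trans fewer-outside b)) opP∪x
      ... | Q , P∪x⊆Q , maxQ = Q , (λ y∈P → P∪x⊆Q (p⊆p∪q _ y∈P)) , maxQ

  dominated-free : ∀ {P v x} → OpenPacking G P → v ∈ P → NeighbourhoodWithin x v
                 → ∀ u → u ∈ P → u ≢ v → ¬ CommonNeighbour u x
  dominated-free opP v∈P x⊑v u u∈P u≢v (w , uw , wx) =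
    opP u _ u∈P v∈P u≢v (w , uw , Graph.sym G (x⊑v w (Graph.sym G wx)))

  dominated-∉ : ∀ {P v x w} → OpenPacking G P → v ∈ P → NeighbourhoodWithin x v
              → x ≢ v → Adj G x w → x ∉ P
  dominated-∉ {w = w} opP v∈P x⊑v x≢v xw x∈P =
    dominated-free opP v∈P x⊑v _ x∈P x≢v (w , xw , Graph.sym G xw)

  replace-packing : ∀ {P v x y} → OpenPacking G P → v ∈ P
    → NeighbourhoodWithin x v → NeighbourhoodWithin y v → ¬ CommonNeighbour x y
    → OpenPacking G (((P - v) ∪ ⁅ x ⁆) ∪ ⁅ y ⁆)
  replace-packing {P} {v} {x} {y} opP v∈P x⊑v y⊑v x-y-apart =
    packing-∪⁅⁆ (packing-∪⁅⁆ opP-v (free-from-rest x⊑v)) y-free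
    where
    opP-v : OpenPacking G (P - v)
    opP-v = packing-⊆ (p─q⊆p P ⁅ v ⁆) opP
    free-from-rest : ∀ {z} → NeighbourhoodWithin z v
                   → ∀ u → u ∈ P - v → u ≢ z → ¬ CommonNeighbour u z
    free-from-rest z⊑v u u∈ _ = dominated-free opP v∈P z⊑v u
      (p─q⊆p P ⁅ v ⁆ u∈) (x∉⁅y⁆⇒x≢y (x∈p─q⇒x∉q P ⁅ v ⁆ u∈))
    y-free : ∀ u → u ∈ (P - v) ∪ ⁅ x ⁆ → u ≢ y → ¬ CommonNeighbour u y
    y-free u u∈ u≢y with x∈p∪q⁻ (P - v) ⁅ x ⁆ u∈
    ... | inj₁ u∈P-v = free-from-rest y⊑v u u∈P-v u≢y
    ... | inj₂ u∈x rewrite x∈⁅y⁆⇒x≡y x u∈x = x-y-apart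

  Pendant : Fin n → Fin n → Set
  Pendant s l = Adj G s l × DegreeOne G l

  pendant-neighbour : ∀ {s l} → Pendant s l → ∀ w → Adj G l w → w ≡ s
  pendant-neighbour {s} (sl , _ , _ , only) w lw =
    trans (only w lw) (≡-sym (only s (Graph.sym G sl)))

  pendant-within : ∀ {v s l} → Adj G v s → Pendant s l → NeighbourhoodWithin l v
  pendant-within vs pl w lw = subst (Adj G _) (≡-sym (pendant-neighbour pl w lw)) vs

  pendant-≢ : ∀ {v s t l} → Adj G v t → s ≢ t → Pendant s l → l ≢ v
  pendant-≢ {t = t} vt s≢t pl refl = s≢t (≡-sym (pendant-neighbour pl t vt))

  pendants-apart : ∀ {s t l m} → s ≢ t → Pendant s l → Pendant t m
                 → ¬ CommonNeighbour l m
  pendants-apart s≢t pl pm (w , lw , wm) =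
    s≢t (trans (≡-sym (pendant-neighbour pl w lw)) (pendant-neighbour pm w (Graph.sym G wm)))

  pendants-≢ : ∀ {s t l m} → s ≢ t → Pendant s l → Pendant t m → l ≢ m
  pendants-≢ {s} s≢t (sl , _) pm refl =
    s≢t (pendant-neighbour pm s (Graph.sym G sl))

lemma1 : ∀ {n} (G : Graph n) → TriangleFree G
    → (∀ P Q → MaximalOpenPacking G P → MaximalOpenPacking G Q → ∣ P ∣ ≡ ∣ Q ∣)
    → ∀ v s t → Adj G v s → Adj G v t → Support G s → Support G t → s ≡ t
lemma1 G _ equal-size v s t vs vt (l , pl) (m , pm) with s ≟ t
... | yes s≡t = s≡t
... | no s≢t =
  let
      Q , ⁅v⁆⊆Q , maxQ = maximal-extension G ⁅ v ⁆ (packing-⁅⁆ G v)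
      opQ = proj₁ maxQ
      v∈Q = ⁅v⁆⊆Q (x∈⁅x⁆ v)
      l⊑v = pendant-within G vs pl
      m⊑v = pendant-within G vt pm
      R = ((Q - v) ∪ ⁅ l ⁆) ∪ ⁅ m ⁆
      Q' , R⊆Q' , maxQ' = maximal-extension G R
        (replace-packing G opQ v∈Q l⊑v m⊑v (pendants-apart G s≢t pl pm))
      l∉Q = dominated-∉ G opQ v∈Q l⊑v (pendant-≢ G vt s≢t pl) (Graph.sym G (proj₁ pl))
      m∉Q = dominated-∉ G opQ v∈Q m⊑v (pendant-≢ G vs (λ t≡s → s≢t (≡-sym t≡s)) pm)
              (Graph.sym G (proj₁ pm))
      Q<R = ∣p∣<∣p-v∪x∪y∣ Q v∈Q l∉Q m∉Q (pendants-≢ G s≢t pl pm)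
  in ⊥-elim (<⇒≢ (<-≤-trans Q<R (p⊆q⇒∣p∣≤∣q∣ R⊆Q')) (equal-size Q Q' maxQ maxQ'))
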